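{- Let $D=(V,F)$ be a digraph with the tournament Sidorenko property, and let $v\notin V$ be a new vertex. Then the digraph $D'=(V\cup\{v\},F')$ with $F'=F\cup\{(v,w): w\in V\}$ has the tournament Sidorenko property.
   Context: All digraphs are oriented graphs (no loops, no antiparallel edges). A tournament is an orientation of a complete graph without loops. For digraphs $D,T$, $h_D(T)$ is the number of maps $\phi:V(D)\to V(T)$ with $(\phi(x),\phi(y))\in E(T)$ for all $(x,y)\in E(D)$, and $t_D(T)=h_D(T)/v(T)^{v(D)}$. A digraph $D$ has the tournament Sidorenko property if $t_D(T)\ge (1-o(1))2^{ -e(D)}$ for all tournaments $T$, where $o(1)\to 0$ as the number of vertices of $T$ tends to infinity (i.e. for every $\varepsilon>0$ there is $N$ such that every tournament $T$ on at least $N$ vertices satisfies $t_D(T)\ge(1-\varepsilon)2^{ -e(D)}$). -}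

module Defs where

open import Data.Nat using (ℕ; zero; suc; _+_; _*_; _∸_; _^_; _≤_)
open import Data.Bool using (Bool; true; false; not; _∧_; _∨_; _xor_; if_then_else_)
open import Data.Fin using (Fin; zero; suc)
open import Data.Vec using (Vec; []; _∷_; lookup)
open import Data.List using (List; []; _∷_; [_]; map; concatMap; allFin; length; filter)
open import Data.Product using (_×_; _,_)
open import Relation.Binary.PropositionalEquality using (_≡_; _≢_; refl)
open import Relation.Nullary using (¬_)
open import Data.Bool.Properties using (T?)
open import Data.Bool.ListAction using (and)
open import Data.Bool using (T)

record Digraph : Set where
  field
    order    : ℕ
    edge     : Fin order → Fin order → Bool
    loopless : ∀ x → edge x x ≡ false
    oriented : ∀ x y → edge x y ≡ true → edge y x ≡ false
open Digraph public

record Tournament (n : ℕ) : Set where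
  field
    arc       : Fin n → Fin n → Bool
    arc-irrefl : ∀ i → arc i i ≡ false
    arc-tourn  : ∀ i j → i ≢ j → (arc i j xor arc j i) ≡ true
open Tournament public

allPairs : (m : ℕ) → List (Fin m × Fin m)
allPairs m = concatMap (λ x → map (λ y → (x , y)) (allFin m)) (allFin m)

e : Digraph → ℕ
e D = length (filter (λ p → T? (edge D (Data.Product.proj₁ p) (Data.Product.proj₂ p)))
                     (allPairs (order D)))

allMaps : (m n : ℕ) → List (Vec (Fin n) m)
allMaps zero    n = [ [] ]
allMaps (suc m) n = concatMap (λ i → map (i ∷_) (allMaps m n)) (allFin n)

isHom : (D : Digraph) {n : ℕ} → Tournament n → Vec (Fin n) (order D) → Bool
isHom D Tn φ = and (map (λ p → not (edge D (Data.Product.proj₁ p) (Data.Product.proj₂ p))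
                               ∨ arc Tn (lookup φ (Data.Product.proj₁ p)) (lookup φ (Data.Product.proj₂ p)))
                        (allPairs (order D)))

hom : (D : Digraph) {n : ℕ} → Tournament n → ℕ
hom D Tn = length (filter (λ φ → T? (isHom D Tn φ)) (allMaps (order D) _))

-- Tournament Sidorenko property: for every rational ε = a/b > 0 there is N
-- such that every tournament T on n ≥ N vertices has
--   t_D(T) ≥ (1 - ε) 2^{-e(D)},  i.e.  b · h_D(T) · 2^{e(D)} ≥ (b - a) · n^{v(D)}
-- (with truncated subtraction; if a ≥ b the condition is trivially true, as it
-- is for the real inequality).
TournamentSidorenko : Digraph → Set
TournamentSidorenko D =
  ∀ (a b : ℕ) → 1 ≤ a → 1 ≤ b →
  Data.Product.∃ λ N → ∀ (n : ℕ) → N ≤ n → (Tn : Tournament n) →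
    (b ∸ a) * n ^ order D ≤ b * hom D Tn * 2 ^ e D

coneEdge : (D : Digraph) → Fin (suc (order D)) → Fin (suc (order D)) → Bool
coneEdge D zero    zero    = false
coneEdge D zero    (suc w) = true
coneEdge D (suc x) zero    = false
coneEdge D (suc x) (suc y) = edge D x y

coneEdge-loopless : (D : Digraph) → ∀ x → coneEdge D x x ≡ false
coneEdge-loopless D zero    = refl
coneEdge-loopless D (suc x) = loopless D x

coneEdge-oriented : (D : Digraph) → ∀ x y → coneEdge D x y ≡ true → coneEdge D y x ≡ false
coneEdge-oriented D zero    (suc y) _ = refl
coneEdge-oriented D (suc x) (suc y) p = oriented D x y p

cone : Digraph → Digraph
cone D = record
  { order    = suc (order D)
  ; edge     = coneEdge D
  ; loopless = coneEdge-loopless D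
  ; oriented = coneEdge-oriented D
  }

-- A homomorphism of cone D into T is an image u of the apex together with a homomorphism of D
-- into the subtournament on the out-neighbourhood of u, so h(cone D, T) = Σ_u h(D, T[N⁺(u)]).
-- Applying the property of D with error 1/(4b), where ε = a/b, to the large out-neighbourhoods
-- (and bounding the small ones trivially) gives h(cone D, T) ≳ 2^{-e(D)} Σ_u d⁺(u)^k. The
-- out-degrees sum to n(n-1)/2, so by the power-mean inequality Σ_u d⁺(u)^k ≥ n((n-1)/2)^k,
-- which is n^{k+1}/2^k up to lower-order terms, and e(cone D) = k + e(D).
module Submission where

open import Defs
open import Data.Bool using (Bool; true; false; not; _∧_; _∨_; _xor_; if_then_else_)
open import Data.Bool.ListAction using (and)
open import Data.Bool.Properties using (T?; ∧-assoc)
open import Data.Fin using (Fin; zero; suc; punchIn)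
import Data.Fin.Properties as Fin
open import Data.List using (List; []; _∷_; map; concatMap; allFin; length; filter; _++_; tabulate)
open import Data.List.Properties using (map-tabulate)
open import Data.Nat using (ℕ; zero; suc; _+_; _*_; _∸_; _^_; _≤_; z≤n; s≤s; _≤?_)
open import Data.Nat.Properties
open import Algebra.Properties.Semiring.Sum +-*-semiring
  using (sum; sum-syntax; sum-cong-≗; sum-remove; ∑-distrib-+; ∑-comm; *-distribˡ-sum; *-distribʳ-sum)
open import Data.Nat.Tactic.RingSolver using (solve-∀)
open import Data.Product using (_×_; _,_)
open import Data.Sum using (inj₁; inj₂)
open import Data.Vec using (Vec; []; _∷_; lookup)
import Data.Vec as Vec
open import Data.Vec.Properties using (lookup-map)
open import Function using (_∘_; id)
open import Function.Definitions using (Injective)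
open import Relation.Nullary using (yes; no)
open import Relation.Binary.PropositionalEquality

indicator : Bool → ℕ
indicator true  = 1
indicator false = 0

allᶠ : ∀ n → (Fin n → Bool) → Bool
allᶠ zero    p = true
allᶠ (suc n) p = p zero ∧ allᶠ n (p ∘ suc)

allᶠ-cong : ∀ n {p q : Fin n → Bool} → (∀ i → p i ≡ q i) → allᶠ n p ≡ allᶠ n q
allᶠ-cong zero    p≗q = refl
allᶠ-cong (suc n) p≗q = cong₂ _∧_ (p≗q zero) (allᶠ-cong n (p≗q ∘ suc))

∑-const : ∀ n c → ∑[ i < n ] c ≡ n * c
∑-const zero    c = refl
∑-const (suc n) c = cong (c +_) (∑-const n c)

∑-mono-≤ : ∀ n {f g : Fin n → ℕ} → (∀ i → f i ≤ g i) → sum f ≤ sum g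
∑-mono-≤ zero    f≤g = z≤n
∑-mono-≤ (suc n) f≤g = +-mono-≤ (f≤g zero) (∑-mono-≤ n (f≤g ∘ suc))

private
  variable
    A A′ : Set

countᵇ : (A → Bool) → List A → ℕ
countᵇ p xs = length (filter (λ x → T? (p x)) xs)

countᵇ-∷ : ∀ (p : A → Bool) x xs → countᵇ p (x ∷ xs) ≡ indicator (p x) + countᵇ p xs
countᵇ-∷ p x xs with p x
... | true  = refl
... | false = refl

countᵇ-++ : ∀ (p : A → Bool) xs ys → countᵇ p (xs ++ ys) ≡ countᵇ p xs + countᵇ p ys
countᵇ-++ p []       ys = refl
countᵇ-++ p (x ∷ xs) ys = begin
  countᵇ p (x ∷ xs ++ ys)                           ≡⟨ countᵇ-∷ p x (xs ++ ys) ⟩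
  indicator (p x) + countᵇ p (xs ++ ys)             ≡⟨ cong (indicator (p x) +_) (countᵇ-++ p xs ys) ⟩
  indicator (p x) + (countᵇ p xs + countᵇ p ys)     ≡⟨ +-assoc (indicator (p x)) _ _ ⟨
  (indicator (p x) + countᵇ p xs) + countᵇ p ys     ≡⟨ cong (_+ countᵇ p ys) (countᵇ-∷ p x xs) ⟨
  countᵇ p (x ∷ xs) + countᵇ p ys                   ∎
  where open ≡-Reasoning

countᵇ-tabulate : ∀ (p : A → Bool) {n} (f : Fin n → A) → countᵇ p (tabulate f) ≡ ∑[ i < n ] indicator (p (f i))
countᵇ-tabulate p {zero}  f = refl
countᵇ-tabulate p {suc n} f =
  trans (countᵇ-∷ p (f zero) _) (cong (indicator (p (f zero)) +_) (countᵇ-tabulate p (f ∘ suc)))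

countᵇ-concatMap-tabulate : ∀ (p : A → Bool) (f : A′ → List A) {n} (g : Fin n → A′) →
  countᵇ p (concatMap f (tabulate g)) ≡ ∑[ i < n ] countᵇ p (f (g i))
countᵇ-concatMap-tabulate p f {zero}  g = refl
countᵇ-concatMap-tabulate p f {suc n} g =
  trans (countᵇ-++ p (f (g zero)) _) (cong (countᵇ p (f (g zero)) +_) (countᵇ-concatMap-tabulate p f (g ∘ suc)))

countᵇ-map : ∀ (p : A′ → Bool) (f : A → A′) xs → countᵇ p (map f xs) ≡ countᵇ (p ∘ f) xs
countᵇ-map p f []       = refl
countᵇ-map p f (x ∷ xs) = trans (countᵇ-∷ p (f x) (map f xs))
  (trans (cong (indicator (p (f x)) +_) (countᵇ-map p f xs)) (sym (countᵇ-∷ (p ∘ f) x xs)))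

and-map-++ : ∀ (p : A → Bool) xs ys → and (map p (xs ++ ys)) ≡ and (map p xs) ∧ and (map p ys)
and-map-++ p []       ys = refl
and-map-++ p (x ∷ xs) ys = trans (cong (p x ∧_) (and-map-++ p xs ys)) (sym (∧-assoc (p x) _ _))

and-map-tabulate : ∀ (p : A → Bool) {n} (f : Fin n → A) → and (map p (tabulate f)) ≡ allᶠ n (p ∘ f)
and-map-tabulate p {zero}  f = refl
and-map-tabulate p {suc n} f = cong (p (f zero) ∧_) (and-map-tabulate p (f ∘ suc))

and-map-concatMap-tabulate : ∀ (p : A → Bool) (f : A′ → List A) {n} (g : Fin n → A′) →
  and (map p (concatMap f (tabulate g))) ≡ allᶠ n (λ i → and (map p (f (g i))))
and-map-concatMap-tabulate p f {zero}  g = refl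
and-map-concatMap-tabulate p f {suc n} g = trans (and-map-++ p (f (g zero)) _)
  (cong (and (map p (f (g zero))) ∧_) (and-map-concatMap-tabulate p f (g ∘ suc)))

countᵇ-allPairs : ∀ m (p : Fin m × Fin m → Bool) →
  countᵇ p (allPairs m) ≡ ∑[ x < m ] ∑[ y < m ] indicator (p (x , y))
countᵇ-allPairs m p = trans (countᵇ-concatMap-tabulate p (λ x → map (x ,_) (allFin m)) {m} id)
  (sum-cong-≗ (λ x → trans (cong (countᵇ p) (map-tabulate id (x ,_))) (countᵇ-tabulate p (x ,_))))

and-map-allPairs : ∀ m (p : Fin m × Fin m → Bool) →
  and (map p (allPairs m)) ≡ allᶠ m (λ x → allᶠ m (λ y → p (x , y)))
and-map-allPairs m p = trans (and-map-concatMap-tabulate p (λ x → map (x ,_) (allFin m)) {m} id)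
  (allᶠ-cong m (λ x → trans (cong (and ∘ map p) (map-tabulate id (x ,_))) (and-map-tabulate p (x ,_))))

countMaps : ∀ k n → (Vec (Fin n) k → Bool) → ℕ
countMaps zero    n p = indicator (p [])
countMaps (suc k) n p = ∑[ i < n ] countMaps k n (λ φ → p (i ∷ φ))

countMaps-cong : ∀ k n {p q : Vec (Fin n) k → Bool} → (∀ φ → p φ ≡ q φ) → countMaps k n p ≡ countMaps k n q
countMaps-cong zero    n p≗q = cong indicator (p≗q [])
countMaps-cong (suc k) n p≗q = sum-cong-≗ (λ i → countMaps-cong k n (λ φ → p≗q (i ∷ φ)))

countMaps-false : ∀ k n → countMaps k n (λ _ → false) ≡ 0
countMaps-false zero    n = refl
countMaps-false (suc k) n = trans (sum-cong-≗ {n} (λ _ → countMaps-false k n)) (trans (∑-const n 0) (*-zeroʳ n))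

countᵇ-allMaps : ∀ k n (p : Vec (Fin n) k → Bool) → countᵇ p (allMaps k n) ≡ countMaps k n p
countᵇ-allMaps zero    n p with p []
... | true  = refl
... | false = refl
countᵇ-allMaps (suc k) n p = trans (countᵇ-concatMap-tabulate p (λ i → map (i ∷_) (allMaps k n)) id)
  (sum-cong-≗ (λ i → trans (countᵇ-map p (i ∷_) (allMaps k n)) (countᵇ-allMaps k n (λ φ → p (i ∷ φ)))))

hom≡countMaps : (D : Digraph) {n : ℕ} (T : Tournament n) → hom D T ≡ countMaps (order D) n (isHom D T)
hom≡countMaps D T = countᵇ-allMaps (order D) _ (isHom D T)

isHom≡allᶠ : (D : Digraph) {n : ℕ} (T : Tournament n) (φ : Vec (Fin n) (order D)) →
  isHom D T φ ≡ allᶠ (order D) (λ x → allᶠ (order D) (λ y → not (edge D x y) ∨ arc T (lookup φ x) (lookup φ y)))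
isHom≡allᶠ D T φ = and-map-allPairs (order D) _

card : ∀ {n} → (Fin n → Bool) → ℕ
card {n} S = ∑[ j < n ] indicator (S j)

liftEnum : ∀ {c n} b → (Fin c → Fin n) → Fin (indicator b + c) → Fin (suc n)
liftEnum true  e zero    = zero
liftEnum true  e (suc i) = suc (e i)
liftEnum false e i       = suc (e i)

enumerate : ∀ n (S : Fin n → Bool) → Fin (card S) → Fin n
enumerate zero    S ()
enumerate (suc n) S = liftEnum (S zero) (enumerate n (S ∘ suc))

enumerate-injective : ∀ n (S : Fin n → Bool) {i j} → enumerate n S i ≡ enumerate n S j → i ≡ j
enumerate-injective (suc n) S = liftEnum-injective (S zero)
  where
  enum = enumerate n (S ∘ suc)
  liftEnum-injective : ∀ b → Injective _≡_ _≡_ (liftEnum b enum)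
  liftEnum-injective true  {zero}  {zero}  _  = refl
  liftEnum-injective true  {suc i} {suc j} eq = cong suc (enumerate-injective n (S ∘ suc) (Fin.suc-injective eq))
  liftEnum-injective false                 eq = enumerate-injective n (S ∘ suc) (Fin.suc-injective eq)

∑-enumerate : ∀ n (S : Fin n → Bool) (g : Fin n → ℕ) →
  ∑[ i < card S ] g (enumerate n S i) ≡ ∑[ j < n ] (if S j then g j else 0)
∑-enumerate zero    S g = refl
∑-enumerate (suc n) S g = trans (∑-liftEnum (S zero))
  (cong ((if S zero then g zero else 0) +_) (∑-enumerate n (S ∘ suc) (g ∘ suc)))
  where
  enum = enumerate n (S ∘ suc)
  ∑-liftEnum : ∀ b → ∑[ i < indicator b + card (S ∘ suc) ] g (liftEnum b enum i)
                     ≡ (if b then g zero else 0) + ∑[ i < card (S ∘ suc) ] g (suc (enum i))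
  ∑-liftEnum true  = refl
  ∑-liftEnum false = refl

induced : ∀ {n} → Tournament n → (S : Fin n → Bool) → Tournament (card S)
induced {n} T S = record
  { arc        = λ i j → arc T (ι i) (ι j)
  ; arc-irrefl = λ i → arc-irrefl T (ι i)
  ; arc-tourn  = λ i j i≢j → arc-tourn T (ι i) (ι j) (i≢j ∘ enumerate-injective n S)
  }
  where ι = enumerate n S

isHom-induced : (D : Digraph) {n : ℕ} (T : Tournament n) (S : Fin n → Bool) (ψ : Vec (Fin (card S)) (order D)) →
  isHom D (induced T S) ψ ≡ isHom D T (Vec.map (enumerate n S) ψ)
isHom-induced D {n} T S ψ = begin
  isHom D (induced T S) ψ
    ≡⟨ isHom≡allᶠ D (induced T S) ψ ⟩
  allᶠ k (λ x → allᶠ k (λ y → not (edge D x y) ∨ arc T (ι (lookup ψ x)) (ι (lookup ψ y))))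
    ≡⟨ allᶠ-cong k (λ x → allᶠ-cong k (λ y → cong₂ (λ u v → not (edge D x y) ∨ arc T u v)
         (lookup-map x ι ψ) (lookup-map y ι ψ))) ⟨
  allᶠ k (λ x → allᶠ k (λ y → not (edge D x y) ∨ arc T (lookup (Vec.map ι ψ) x) (lookup (Vec.map ι ψ) y)))
    ≡⟨ isHom≡allᶠ D T (Vec.map ι ψ) ⟨
  isHom D T (Vec.map ι ψ) ∎
  where
  open ≡-Reasoning
  k = order D
  ι = enumerate n S

countMaps-enumerate : ∀ k n (S : Fin n → Bool) (p : Vec (Fin n) k → Bool) →
  countMaps k (card S) (p ∘ Vec.map (enumerate n S)) ≡ countMaps k n (λ φ → allᶠ k (S ∘ lookup φ) ∧ p φ)
countMaps-enumerate zero    n S p = refl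
countMaps-enumerate (suc k) n S p = begin
  ∑[ i < card S ] countMaps k (card S) (λ ψ → p (ι i ∷ Vec.map ι ψ))
    ≡⟨ sum-cong-≗ {card S} (λ i → countMaps-enumerate k n S (λ φ → p (ι i ∷ φ))) ⟩
  ∑[ i < card S ] countMaps k n (λ φ → inS φ ∧ p (ι i ∷ φ))
    ≡⟨ ∑-enumerate n S (λ j → countMaps k n (λ φ → inS φ ∧ p (j ∷ φ))) ⟩
  ∑[ j < n ] (if S j then countMaps k n (λ φ → inS φ ∧ p (j ∷ φ)) else 0)
    ≡⟨ sum-cong-≗ {n} (λ j → if-countMaps (S j) (λ φ → p (j ∷ φ))) ⟩
  ∑[ j < n ] countMaps k n (λ φ → (S j ∧ inS φ) ∧ p (j ∷ φ)) ∎
  where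
  open ≡-Reasoning
  ι = enumerate n S
  inS : Vec (Fin n) k → Bool
  inS φ = allᶠ k (S ∘ lookup φ)
  if-countMaps : ∀ b (q : Vec (Fin n) k → Bool) →
    (if b then countMaps k n (λ φ → inS φ ∧ q φ) else 0) ≡ countMaps k n (λ φ → (b ∧ inS φ) ∧ q φ)
  if-countMaps true  q = refl
  if-countMaps false q = sym (countMaps-false k n)

isHom-cone : (D : Digraph) {n : ℕ} (T : Tournament n) (u : Fin n) (φ : Vec (Fin n) (order D)) →
  isHom (cone D) T (u ∷ φ) ≡ allᶠ (order D) (arc T u ∘ lookup φ) ∧ isHom D T φ
isHom-cone D T u φ = trans (isHom≡allᶠ (cone D) T (u ∷ φ))
  (cong (allᶠ (order D) (arc T u ∘ lookup φ) ∧_) (sym (isHom≡allᶠ D T φ)))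

hom-cone : (D : Digraph) {n : ℕ} (T : Tournament n) →
  hom (cone D) T ≡ ∑[ u < n ] hom D (induced T (arc T u))
hom-cone D {n} T = trans (hom≡countMaps (cone D) T) (sum-cong-≗ {n} (λ u → sym (begin
  hom D (induced T (arc T u))
    ≡⟨ hom≡countMaps D (induced T (arc T u)) ⟩
  countMaps k _ (isHom D (induced T (arc T u)))
    ≡⟨ countMaps-cong k _ (isHom-induced D T (arc T u)) ⟩
  countMaps k _ (isHom D T ∘ Vec.map (enumerate n (arc T u)))
    ≡⟨ countMaps-enumerate k n (arc T u) (isHom D T) ⟩
  countMaps k n (λ φ → allᶠ k (arc T u ∘ lookup φ) ∧ isHom D T φ)
    ≡⟨ countMaps-cong k n (λ φ → isHom-cone D T u φ) ⟨
  countMaps k n (λ φ → isHom (cone D) T (u ∷ φ)) ∎)))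
  where
  open ≡-Reasoning
  k = order D

hom-order-zero : (D : Digraph) → order D ≡ 0 → ∀ {n} (T : Tournament n) → hom D T ≡ 1
hom-order-zero D k≡0 {n} T =
  trans (hom≡countMaps D T) (trans (countMaps-cong (order D) n (isHom≡allᶠ D T)) (countMaps-allᶠ-empty _ _ k≡0))
  where
  countMaps-allᶠ-empty : ∀ k (p : Vec (Fin n) k → Fin k → Bool) → k ≡ 0 → countMaps k n (λ φ → allᶠ k (p φ)) ≡ 1
  countMaps-allᶠ-empty zero p refl = refl

e-cone : ∀ D → e (cone D) ≡ order D + e D
e-cone D = trans (countᵇ-allPairs (suc k) (edgeᵖ (cone D)))
  (cong₂ _+_ (trans (∑-const k 1) (*-identityʳ k)) (sym (countᵇ-allPairs k (edgeᵖ D))))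
  where
  k = order D
  edgeᵖ : ∀ G → Fin (order G) × Fin (order G) → Bool
  edgeᵖ G (x , y) = edge G x y

outdeg : ∀ {n} → Tournament n → Fin n → ℕ
outdeg T u = card (arc T u)

indicator-xor : ∀ b c → (b xor c) ≡ true → indicator b + indicator c ≡ 1
indicator-xor true  false _ = refl
indicator-xor false true  _ = refl

∑-outdeg : ∀ m (T : Tournament (suc m)) → ∑[ u < suc m ] outdeg T u + ∑[ u < suc m ] outdeg T u ≡ suc m * m
∑-outdeg m T = begin
  s + s
    ≡⟨ cong (s +_) (∑-comm a) ⟩
  s + ∑[ u < n ] ∑[ v < n ] a v u
    ≡⟨ ∑-distrib-+ (λ u → ∑[ v < n ] a u v) (λ u → ∑[ v < n ] a v u) ⟨
  ∑[ u < n ] (∑[ v < n ] a u v + ∑[ v < n ] a v u)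
    ≡⟨ sum-cong-≗ {n} (λ u → sym (∑-distrib-+ (a u) (λ v → a v u))) ⟩
  ∑[ u < n ] ∑[ v < n ] (a u v + a v u)
    ≡⟨ sum-cong-≗ {n} row ⟩
  ∑[ u < n ] m
    ≡⟨ ∑-const n m ⟩
  n * m ∎
  where
  open ≡-Reasoning
  n = suc m
  a : Fin n → Fin n → ℕ
  a u v = indicator (arc T u v)
  s = ∑[ u < n ] ∑[ v < n ] a u v
  -- Each vertex v ≠ u contributes exactly one of the arcs uv, vu; the term v = u is removed.
  row : ∀ u → ∑[ v < n ] (a u v + a v u) ≡ m
  row u = begin
    ∑[ v < n ] (a u v + a v u)
      ≡⟨ sum-remove {i = u} (λ v → a u v + a v u) ⟩
    (a u u + a u u) + ∑[ j < m ] (a u (punchIn u j) + a (punchIn u j) u)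
      ≡⟨ cong₂ _+_ (cong (λ b → indicator b + indicator b) (arc-irrefl T u)) (sum-cong-≗ {m} (λ j →
           indicator-xor (arc T u (punchIn u j)) (arc T (punchIn u j) u) (arc-tourn T u (punchIn u j) (Fin.punchInᵢ≢i u j ∘ sym)))) ⟩
    ∑[ j < m ] 1
      ≡⟨ ∑-const m 1 ⟩
    m * 1
      ≡⟨ *-identityʳ m ⟩
    m ∎

rearrangement : ∀ {a b c d} → a ≤ b → c ≤ d → a * d + b * c ≤ a * c + b * d
rearrangement {a} {b} {c} {d} a≤b c≤d = subst₂ (λ b d → a * d + b * c ≤ a * c + b * d)
  (m+[n∸m]≡n a≤b) (m+[n∸m]≡n c≤d) (subst (a * (c + (d ∸ c)) + (a + (b ∸ a)) * c ≤_) (expand a c (b ∸ a) (d ∸ c)) (m≤m+n _ _))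
  where
  expand : ∀ a c t s → a * (c + s) + (a + t) * c + t * s ≡ a * c + (a + t) * (c + s)
  expand = solve-∀

chebyshev : ∀ n (x y : Fin n → ℕ) → (∀ i j → x i * y j + x j * y i ≤ x i * y i + x j * y j) →
  sum x * sum y ≤ n * ∑[ i < n ] (x i * y i)
chebyshev n x y similar = *-cancelˡ-≤ 2 (begin
  2 * (X * Y)
    ≡⟨ cong (X * Y +_) (+-identityʳ (X * Y)) ⟩
  X * Y + X * Y
    ≡⟨ cong₂ _+_ XY≡∑∑ (trans XY≡∑∑ (∑-comm (λ i j → x i * y j))) ⟩
  ∑[ i < n ] ∑[ j < n ] (x i * y j) + ∑[ i < n ] ∑[ j < n ] (x j * y i)
    ≡⟨ ∑-distrib-+ (λ i → ∑[ j < n ] (x i * y j)) (λ i → ∑[ j < n ] (x j * y i)) ⟨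
  ∑[ i < n ] (∑[ j < n ] (x i * y j) + ∑[ j < n ] (x j * y i))
    ≡⟨ sum-cong-≗ {n} (λ i → ∑-distrib-+ (λ j → x i * y j) (λ j → x j * y i)) ⟨
  ∑[ i < n ] ∑[ j < n ] (x i * y j + x j * y i)
    ≤⟨ ∑-mono-≤ n (λ i → ∑-mono-≤ n (similar i)) ⟩
  ∑[ i < n ] ∑[ j < n ] (x i * y i + x j * y j)
    ≡⟨ sum-cong-≗ {n} (λ i → trans (∑-distrib-+ (λ _ → x i * y i) (λ j → x j * y j)) (cong (_+ Z) (∑-const n (x i * y i)))) ⟩
  ∑[ i < n ] (n * (x i * y i) + Z)
    ≡⟨ ∑-distrib-+ (λ i → n * (x i * y i)) (λ _ → Z) ⟩
  ∑[ i < n ] (n * (x i * y i)) + ∑[ i < n ] Z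
    ≡⟨ cong₂ _+_ (sym (*-distribˡ-sum n (λ i → x i * y i))) (∑-const n Z) ⟩
  n * Z + n * Z
    ≡⟨ cong (n * Z +_) (+-identityʳ (n * Z)) ⟨
  2 * (n * Z) ∎)
  where
  open ≤-Reasoning
  X = sum x
  Y = sum y
  Z = ∑[ i < n ] (x i * y i)
  XY≡∑∑ : X * Y ≡ ∑[ i < n ] ∑[ j < n ] (x i * y j)
  XY≡∑∑ = trans (*-distribʳ-sum Y x) (sum-cong-≗ {n} (λ i → *-distribˡ-sum (x i) y))

power-mean : ∀ n (x : Fin n → ℕ) k → sum x ^ k * n ≤ n ^ k * ∑[ i < n ] (x i ^ k)
power-mean n x zero = ≤-reflexive (trans (+-identityʳ n) (sym (trans (+-identityʳ _) (trans (∑-const n 1) (*-identityʳ n)))))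
power-mean n x (suc k) = begin
  X ^ suc k * n                        ≡⟨ *-assoc X (X ^ k) n ⟩
  X * (X ^ k * n)                      ≤⟨ *-monoʳ-≤ X (power-mean n x k) ⟩
  X * (n ^ k * Sₖ)                      ≡⟨ x*[y*z]≡y*[x*z] X (n ^ k) Sₖ ⟩
  n ^ k * (X * Sₖ)                      ≤⟨ *-monoʳ-≤ (n ^ k) (chebyshev n x (λ i → x i ^ k) similar) ⟩
  n ^ k * (n * ∑[ i < n ] (x i ^ suc k)) ≡⟨ *-assoc (n ^ k) n _ ⟨
  n ^ k * n * ∑[ i < n ] (x i ^ suc k)   ≡⟨ cong (_* ∑[ i < n ] (x i ^ suc k)) (*-comm (n ^ k) n) ⟩
  n ^ suc k * ∑[ i < n ] (x i ^ suc k)   ∎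
  where
  open ≤-Reasoning
  X = sum x
  Sₖ = ∑[ i < n ] (x i ^ k)
  x*[y*z]≡y*[x*z] : ∀ a b c → a * (b * c) ≡ b * (a * c)
  x*[y*z]≡y*[x*z] = solve-∀
  similar : ∀ i j → x i * x j ^ k + x j * x i ^ k ≤ x i * x i ^ k + x j * x j ^ k
  similar i j with ≤-total (x i) (x j)
  ... | inj₁ xi≤xj = rearrangement xi≤xj (^-monoˡ-≤ k xi≤xj)
  ... | inj₂ xj≤xi = subst₂ _≤_ (+-comm (x j * x i ^ k) _) (+-comm (x j * x j ^ k) _)
                       (rearrangement xj≤xi (^-monoˡ-≤ k xj≤xi))

^-distribʳ-* : ∀ a b k → (a * b) ^ k ≡ a ^ k * b ^ k
^-distribʳ-* a b zero    = refl
^-distribʳ-* a b (suc k) = trans (cong (a * b *_) (^-distribʳ-* a b k)) (interchange a b (a ^ k) (b ^ k))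
  where
  interchange : ∀ a b x y → a * b * (x * y) ≡ a * x * (b * y)
  interchange = solve-∀

outdeg-power-sum : ∀ m k (T : Tournament (suc m)) → suc m * m ^ k ≤ 2 ^ k * ∑[ u < suc m ] (outdeg T u ^ k)
outdeg-power-sum m k T = *-cancelˡ-≤ (n ^ k) {{m^n≢0 n k}} (begin
  n ^ k * (n * m ^ k)   ≡⟨ x*[y*z]≡x*z*y (n ^ k) n (m ^ k) ⟩
  n ^ k * m ^ k * n     ≡⟨ cong (_* n) (^-distribʳ-* n m k) ⟨
  (n * m) ^ k * n       ≡⟨ cong (λ z → z ^ k * n) (∑-outdeg m T) ⟨
  (s + s) ^ k * n       ≡⟨ cong (λ z → (s + z) ^ k * n) (+-identityʳ s) ⟨
  (2 * s) ^ k * n       ≡⟨ cong (_* n) (^-distribʳ-* 2 s k) ⟩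
  2 ^ k * s ^ k * n     ≡⟨ *-assoc (2 ^ k) (s ^ k) n ⟩
  2 ^ k * (s ^ k * n)   ≤⟨ *-monoʳ-≤ (2 ^ k) (power-mean n (outdeg T) k) ⟩
  2 ^ k * (n ^ k * S)   ≡⟨ x*[y*z]≡y*[x*z] (2 ^ k) (n ^ k) S ⟩
  n ^ k * (2 ^ k * S)   ∎)
  where
  open ≤-Reasoning
  n = suc m
  s = ∑[ u < n ] outdeg T u
  S = ∑[ u < n ] (outdeg T u ^ k)
  x*[y*z]≡x*z*y : ∀ x y z → x * (y * z) ≡ x * z * y
  x*[y*z]≡x*z*y = solve-∀
  x*[y*z]≡y*[x*z] : ∀ x y z → x * (y * z) ≡ y * (x * z)
  x*[y*z]≡y*[x*z] = solve-∀

sidorenko-up-to-error : ∀ D c B E N → (∀ n → N ≤ n → (T : Tournament n) → c * n ^ order D ≤ B * hom D T * 2 ^ E) →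
  ∀ {n} (T : Tournament n) → c * n ^ order D ≤ B * hom D T * 2 ^ E + c * N ^ order D
sidorenko-up-to-error D c B E N large {n} T with N ≤? n
... | yes N≤n = ≤-trans (large n N≤n T) (m≤m+n _ _)
... | no  N≰n = ≤-trans (*-monoʳ-≤ c (^-monoˡ-≤ (order D) (<⇒≤ (≰⇒> N≰n)))) (m≤n+m _ _)

∑-outneighbourhood-sidorenko : ∀ D c B N → (∀ n → N ≤ n → (T : Tournament n) → c * n ^ order D ≤ B * hom D T * 2 ^ e D) →
  ∀ {n} (T : Tournament n) →
  c * ∑[ u < n ] (outdeg T u ^ order D) ≤ B * ∑[ u < n ] hom D (induced T (arc T u)) * 2 ^ e D + n * (c * N ^ order D)
∑-outneighbourhood-sidorenko D c B N large {n} T = begin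
  c * ∑[ u < n ] (outdeg T u ^ k)                     ≡⟨ *-distribˡ-sum c (λ u → outdeg T u ^ k) ⟩
  ∑[ u < n ] (c * outdeg T u ^ k)                     ≤⟨ ∑-mono-≤ n (λ u → sidorenko-up-to-error D c B E N large (T⁺ u)) ⟩
  ∑[ u < n ] (B * h u * 2 ^ E + c * N ^ k)            ≡⟨ ∑-distrib-+ (λ u → B * h u * 2 ^ E) (λ _ → c * N ^ k) ⟩
  ∑[ u < n ] (B * h u * 2 ^ E) + ∑[ u < n ] (c * N ^ k)
    ≡⟨ cong₂ _+_ (trans (cong (_* 2 ^ E) (*-distribˡ-sum B h)) (*-distribʳ-sum (2 ^ E) (λ u → B * h u))) (sym (∑-const n _)) ⟨
  B * ∑[ u < n ] h u * 2 ^ E + n * (c * N ^ k)        ∎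
  where
  open ≤-Reasoning
  k = order D
  E = e D
  T⁺ : (u : Fin n) → Tournament (outdeg T u)
  T⁺ u = induced T (arc T u)
  h : Fin n → ℕ
  h u = hom D (T⁺ u)

[1+m]^[1+k]≤[1+m]*m^k+k*[1+m]^k : ∀ m k → suc m ^ suc k ≤ suc m * m ^ k + k * suc m ^ k
[1+m]^[1+k]≤[1+m]*m^k+k*[1+m]^k m zero    = ≤-reflexive (sym (+-identityʳ _))
[1+m]^[1+k]≤[1+m]*m^k+k*[1+m]^k m (suc k) = begin
  n ^ suc (suc k)                         ≡⟨ +-comm (n ^ suc k) (m * n ^ suc k) ⟩
  m * n ^ suc k + n ^ suc k               ≤⟨ +-monoˡ-≤ (n ^ suc k) (*-monoʳ-≤ m ([1+m]^[1+k]≤[1+m]*m^k+k*[1+m]^k m k)) ⟩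
  m * (n * m ^ k + k * n ^ k) + n ^ suc k ≡⟨ expand m (m ^ k) k (n ^ k) ⟩
  n * (m * m ^ k) + (k * (m * n ^ k) + n ^ suc k)
    ≤⟨ +-monoʳ-≤ (n * (m * m ^ k)) (+-monoˡ-≤ (n ^ suc k) (*-monoʳ-≤ k (*-monoˡ-≤ (n ^ k) (n≤1+n m)))) ⟩
  n * (m * m ^ k) + (k * (n * n ^ k) + n ^ suc k) ≡⟨ cong (n * m ^ suc k +_) (+-comm (k * n ^ suc k) (n ^ suc k)) ⟩
  n * m ^ suc k + suc k * n ^ suc k       ∎
  where
  open ≤-Reasoning
  n = suc m
  expand : ∀ m a k b → m * ((1 + m) * a + k * b) + (1 + m) * b ≡ (1 + m) * (m * a) + (k * (m * b) + (1 + m) * b)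
  expand = solve-∀

-- With b = 1 + b₀, B = 4b and c = B - 1: from  c Q ≤ B H + c (x + y)  with  x, y ≤ Q / B
-- we get  (B - 2) c Q ≤ B² H,  and  (B - 2)(B - 1) ≥ 16 b (b - 1).
absorb-errors : ∀ b₀ {Q H x y} → (4 * suc b₀ ∸ 1) * Q ≤ 4 * suc b₀ * H + (4 * suc b₀ ∸ 1) * x + (4 * suc b₀ ∸ 1) * y →
  4 * suc b₀ * x ≤ Q → 4 * suc b₀ * y ≤ Q → b₀ * Q ≤ suc b₀ * H
absorb-errors b₀ {Q} {H} {x} {y} cQ≤ Bx≤Q By≤Q = *-cancelˡ-≤ (16 * b) (+-cancelʳ-≤ (c * Q + c * Q) _ _ (begin
  16 * b * (b₀ * Q) + (c * Q + c * Q)  ≤⟨ subst (16 * b * (b₀ * Q) + (c * Q + c * Q) ≤_) (sym Bc≡16bb₀+2c+r) (m≤m+n _ _) ⟩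
  B * (c * Q)                          ≤⟨ *-monoʳ-≤ B cQ≤ ⟩
  B * (B * H + c * x + c * y)          ≡⟨ distribute b H c x y ⟩
  16 * b * (b * H) + (c * (B * x) + c * (B * y)) ≤⟨ +-monoʳ-≤ (16 * b * (b * H)) (+-mono-≤ (*-monoʳ-≤ c Bx≤Q) (*-monoʳ-≤ c By≤Q)) ⟩
  16 * b * (b * H) + (c * Q + c * Q)   ∎))
  where
  open ≤-Reasoning
  b = suc b₀
  B = 4 * b
  c = B ∸ 1
  c≡3+4b₀ : c ≡ 3 + 4 * b₀
  c≡3+4b₀ = cong (_∸ 1) (4[1+x]≡1+[3+4x] b₀)
    where
    4[1+x]≡1+[3+4x] : ∀ x → 4 * suc x ≡ suc (3 + 4 * x)
    4[1+x]≡1+[3+4x] = solve-∀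
  Bc≡16bb₀+2c+r : B * (c * Q) ≡ 16 * b * (b₀ * Q) + (c * Q + c * Q) + (4 * b₀ + 6) * Q
  Bc≡16bb₀+2c+r = subst (λ c → B * (c * Q) ≡ 16 * b * (b₀ * Q) + (c * Q + c * Q) + (4 * b₀ + 6) * Q)
    (sym c≡3+4b₀) (expand b₀ Q)
    where
    expand : ∀ x q → 4 * suc x * ((3 + 4 * x) * q)
                     ≡ 16 * suc x * (x * q) + ((3 + 4 * x) * q + (3 + 4 * x) * q) + (4 * x + 6) * q
    expand = solve-∀
  distribute : ∀ b H c x y → 4 * b * (4 * b * H + c * x + c * y) ≡ 16 * b * (b * H) + (c * (4 * b * x) + c * (4 * b * y))
  distribute = solve-∀

cone-bound-with-errors : ∀ {c B E N m k H S} → c * S ≤ B * H * 2 ^ E + suc m * (c * N ^ k) → suc m * m ^ k ≤ 2 ^ k * S →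
  c * suc m ^ suc k ≤ B * (H * 2 ^ (k + E)) + c * (suc m * (2 * N) ^ k) + c * (k * suc m ^ k)
cone-bound-with-errors {c} {B} {E} {N} {m} {k} {H} {S} cS≤ n*m^k≤ = begin
  c * n ^ suc k                         ≤⟨ *-monoʳ-≤ c ([1+m]^[1+k]≤[1+m]*m^k+k*[1+m]^k m k) ⟩
  c * (n * m ^ k + k * n ^ k)           ≡⟨ *-distribˡ-+ c (n * m ^ k) (k * n ^ k) ⟩
  c * (n * m ^ k) + c * (k * n ^ k)     ≤⟨ +-monoˡ-≤ (c * (k * n ^ k)) main-term ⟩
  B * (H * 2 ^ (k + E)) + c * (n * (2 * N) ^ k) + c * (k * n ^ k) ∎
  where
  open ≤-Reasoning
  n = suc m
  main-term : c * (n * m ^ k) ≤ B * (H * 2 ^ (k + E)) + c * (n * (2 * N) ^ k)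
  main-term = begin
    c * (n * m ^ k)                            ≤⟨ *-monoʳ-≤ c n*m^k≤ ⟩
    c * (2 ^ k * S)                            ≡⟨ x*[y*z]≡y*[x*z] c (2 ^ k) S ⟩
    2 ^ k * (c * S)                            ≤⟨ *-monoʳ-≤ (2 ^ k) cS≤ ⟩
    2 ^ k * (B * H * 2 ^ E + n * (c * N ^ k))  ≡⟨ distribute (2 ^ k) B H (2 ^ E) n c (N ^ k) ⟩
    B * (H * (2 ^ k * 2 ^ E)) + c * (n * (2 ^ k * N ^ k))
      ≡⟨ cong₂ (λ u v → B * (H * u) + c * (n * v)) (^-distribˡ-+-* 2 k E) (^-distribʳ-* 2 N k) ⟨
    B * (H * 2 ^ (k + E)) + c * (n * (2 * N) ^ k) ∎
    where
    x*[y*z]≡y*[x*z] : ∀ x y z → x * (y * z) ≡ y * (x * z)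
    x*[y*z]≡y*[x*z] = solve-∀
    distribute : ∀ p B H q n c r → p * (B * H * q + n * (c * r)) ≡ B * (H * (p * q)) + c * (n * (p * r))
    distribute = solve-∀

cone-sidorenko-arithmetic : ∀ a b₀ k E N m H S → 1 ≤ a → (k ≡ 0 → suc m ≤ H) →
  (4 * suc b₀ ∸ 1) * S ≤ 4 * suc b₀ * H * 2 ^ E + suc m * ((4 * suc b₀ ∸ 1) * N ^ k) →
  suc m * m ^ k ≤ 2 ^ k * S →
  4 * suc b₀ * k ≤ suc m → 4 * suc b₀ * (2 * N) ≤ suc m →
  (suc b₀ ∸ a) * suc m ^ suc k ≤ suc b₀ * H * 2 ^ (k + E)
cone-sidorenko-arithmetic (suc a₀) b₀ zero E N m H S _ n≤H _ _ _ _ = begin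
  (b₀ ∸ a₀) * (suc m * 1) ≤⟨ *-mono-≤ (≤-trans (m∸n≤m b₀ a₀) (n≤1+n b₀)) (≤-reflexive (*-identityʳ (suc m))) ⟩
  suc b₀ * suc m          ≤⟨ *-monoʳ-≤ (suc b₀) (n≤H refl) ⟩
  suc b₀ * H              ≤⟨ m≤m*n (suc b₀ * H) (2 ^ E) {{m^n≢0 2 E}} ⟩
  suc b₀ * H * 2 ^ E      ∎
  where open ≤-Reasoning
cone-sidorenko-arithmetic (suc a₀) b₀ (suc k) E N m H S _ _ cS≤ n*m^k≤ Bk≤n B2N≤n = begin
  (b₀ ∸ a₀) * Q         ≤⟨ *-monoˡ-≤ Q (m∸n≤m b₀ a₀) ⟩
  b₀ * Q                ≤⟨ absorb-errors b₀ (cone-bound-with-errors {c = B ∸ 1} {B} {E} {N} {m} {suc k} {H} {S} cS≤ n*m^k≤) first-error second-error ⟩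
  suc b₀ * (H * 2 ^ (suc k + E)) ≡⟨ *-assoc (suc b₀) H _ ⟨
  suc b₀ * H * 2 ^ (suc k + E) ∎
  where
  open ≤-Reasoning
  n = suc m
  B = 4 * suc b₀
  Q = n ^ suc (suc k)
  first-error : B * (n * (2 * N) ^ suc k) ≤ Q
  first-error = begin
    B * (n * (2 * N * (2 * N) ^ k)) ≡⟨ x*[y*[z*w]]≡y*[x*z*w] B n (2 * N) ((2 * N) ^ k) ⟩
    n * (B * (2 * N) * (2 * N) ^ k) ≤⟨ *-monoʳ-≤ n (*-mono-≤ B2N≤n (^-monoˡ-≤ k (≤-trans (m≤n*m (2 * N) B) B2N≤n))) ⟩
    Q                               ∎
    where
    x*[y*[z*w]]≡y*[x*z*w] : ∀ x y z w → x * (y * (z * w)) ≡ y * (x * z * w)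
    x*[y*[z*w]]≡y*[x*z*w] = solve-∀
  second-error : B * (suc k * n ^ suc k) ≤ Q
  second-error = ≤-trans (≤-reflexive (sym (*-assoc B (suc k) (n ^ suc k)))) (*-monoˡ-≤ (n ^ suc k) Bk≤n)

proposition1p9 : (D : Digraph) → TournamentSidorenko D → TournamentSidorenko (cone D)
proposition1p9 D sidorenko a (suc b₀) 1≤a _ with sidorenko 1 (4 * suc b₀) (s≤s z≤n) (s≤s z≤n)
... | N , large = suc (B * k + B * (2 * N)) , cone-bound
  where
  k = order D
  B = 4 * suc b₀
  cone-bound : ∀ n → suc (B * k + B * (2 * N)) ≤ n → (T : Tournament n) →
    (suc b₀ ∸ a) * n ^ order (cone D) ≤ suc b₀ * hom (cone D) T * 2 ^ e (cone D)
  cone-bound (suc m) (s≤s threshold≤m) T rewrite hom-cone D T | e-cone D =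
    cone-sidorenko-arithmetic a b₀ k (e D) N m _ _ 1≤a n≤H
      (∑-outneighbourhood-sidorenko D (B ∸ 1) B N large T) (outdeg-power-sum m k T)
      (m≤n⇒m≤1+n (≤-trans (m≤m+n (B * k) _) threshold≤m)) (m≤n⇒m≤1+n (≤-trans (m≤n+m _ (B * k)) threshold≤m))
    where
    n≤H : k ≡ 0 → suc m ≤ ∑[ u < suc m ] hom D (induced T (arc T u))
    n≤H k≡0 = ≤-reflexive (trans (sym (trans (∑-const (suc m) 1) (*-identityʳ (suc m))))
      (sum-cong-≗ {suc m} (λ u → sym (hom-order-zero D k≡0 (induced T (arc T u))))))
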